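{- Let $G$ be a connected simple graph with vertex set $\{v_1,\dots,v_n\}$, let $\mathbb{K}$ be a field, and let $A=(a_{ij})$ be an $n\times n$ matrix over $\mathbb{K}$ with $a_{ij}=0$ whenever $i\neq j$ and $v_i,v_j$ are not adjacent in $G$. Let $\pi=\pi_1\pi_2\cdots\pi_n$ be a permutation of $v_1,\dots,v_n$ (the update schedule). Then the system map of the linear SDS $(G,A,\pi)$ satisfies $$(G,A,\pi)=(I-A_{\pi})^{ -1}(A-A_{\pi}),$$ where $I$ is the $n\times n$ identity matrix and $A_\pi$ is the $n\times n$ matrix with $[A_\pi]_{ij}=a_{ij}$ if $v_i$ appears after $v_j$ in $\pi$, and $[A_\pi]_{ij}=0$ otherwise (in particular all diagonal entries of $A_\pi$ are $0$).
   Context: A linear sequential dynamical system (SDS) $(G,A,\pi)$ over $\mathbb{K}$: each vertex $v_i$ carries a state $x_i\in\mathbb{K}$, and its local function is $f_{v_i}: x_i\mapsto a_{i1}x_1+\cdots+a_{in}x_n$. The local function $f_{v_i}$ induces the map $F_{v_i}:\mathbb{K}^n\to\mathbb{K}^n$ replacing the $i$-th coordinate of $[x_1,\dots,x_n]^T$ by $f_{v_i}(x_i)$ and leaving the others unchanged; as a matrix, $F_{v_i}$ equals the identity matrix except that its $i$-th row is $(a_{i1},\dots,a_{in})$. For an update schedule $\pi=\pi_1\cdots\pi_n$, the system map is $(G,A,\pi)=F_{\pi_n}F_{\pi_{n-1}}\cdots F_{\pi_1}$ (vertices are updated sequentially in the order $\pi_1,\pi_2,\dots$). -}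

module Defs where

open import Level using (Level; _⊔_; suc)
open import Algebra.Bundles using (CommutativeRing)
open import Data.Nat using (ℕ)
import Data.Fin
open import Data.Fin using (Fin; _≟_; _<?_)
open import Data.Fin.Permutation using (Permutation′; _⟨$⟩ʳ_; _⟨$⟩ˡ_)
import Data.List
open import Data.List using (List; []; _∷_)
open import Data.Product using (Σ; ∃; _×_)
open import Relation.Nullary using (¬_; yes; no)
open import Relation.Binary.PropositionalEquality using (_≡_; _≢_)

record Field (c ℓ : Level) : Set (suc (c ⊔ ℓ)) where
  field
    commutativeRing : CommutativeRing c ℓ
  open CommutativeRing commutativeRing public
  field
    0≉1     : ¬ (0# ≈ 1#)
    inverse : ∀ x → ¬ (x ≈ 0#) → ∃ λ y → x * y ≈ 1#

-- Simple graphs on the vertex set Fin n (vertex i ↔ v_{i+1}).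

record SimpleGraph (n : ℕ) : Set₁ where
  field
    Adj       : Fin n → Fin n → Set
    Adj-sym   : ∀ {i j} → Adj i j → Adj j i
    Adj-irrefl : ∀ {i} → ¬ Adj i i

data Reachable {n : ℕ} (G : SimpleGraph n) : Fin n → Fin n → Set where
  here : ∀ {i} → Reachable G i i
  step : ∀ {i j k} → SimpleGraph.Adj G i j → Reachable G j k → Reachable G i k

Connected : ∀ {n} → SimpleGraph n → Set
Connected G = ∀ i j → Reachable G i j

module LinearSDS {c ℓ : Level} (K : Field c ℓ) where
  open Field K

  Matrix : ℕ → Set c
  Matrix n = Fin n → Fin n → Carrier

  ∑ : ∀ {n} → (Fin n → Carrier) → Carrier
  ∑ {ℕ.zero}  f = 0#
  ∑ {ℕ.suc n} f = f Fin.zero + ∑ (λ i → f (Fin.suc i))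

  _⊗_ : ∀ {n} → Matrix n → Matrix n → Matrix n
  (M ⊗ N) i j = ∑ (λ k → M i k * N k j)

  _⊖_ : ∀ {n} → Matrix n → Matrix n → Matrix n
  (M ⊖ N) i j = M i j - N i j

  I : ∀ {n} → Matrix n
  I i j with i ≟ j
  ... | yes _ = 1#
  ... | no  _ = 0#

  _≋_ : ∀ {n} → Matrix n → Matrix n → Set ℓ
  M ≋ N = ∀ i j → M i j ≈ N i j

  IsInverseOf : ∀ {n} → Matrix n → Matrix n → Set ℓ
  IsInverseOf B M = ((B ⊗ M) ≋ I) × ((M ⊗ B) ≋ I)

  F : ∀ {n} → Matrix n → Fin n → Matrix n
  F A i x y with x ≟ i
  ... | yes _ = A x y
  ... | no  _ = I x y

  -- F_{w_m} ⋯ F_{w_1} for the list w_1 ∷ … ∷ w_m (w_1 updated first)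
  compose : ∀ {n} → Matrix n → List (Fin n) → Matrix n
  compose A []       = I
  compose A (v ∷ vs) = compose A vs ⊗ F A v

  -- the list π_1, π_2, …, π_n of an update schedule
  -- (π ⟨$⟩ʳ k is the vertex updated at step k)
  schedule : ∀ {n} → Permutation′ n → List (Fin n)
  schedule π = Data.List.map (π ⟨$⟩ʳ_) (Data.List.allFin _)

  systemMap : ∀ {n} → Matrix n → Permutation′ n → Matrix n
  systemMap A π = compose A (schedule π)

  Aπ : ∀ {n} → Matrix n → Permutation′ n → Matrix n
  Aπ A π i j with (π ⟨$⟩ˡ j) <? (π ⟨$⟩ˡ i)
  ... | yes _ = A i j
  ... | no  _ = 0#

  SupportedOn : ∀ {n} → SimpleGraph n → Matrix n → Set ℓ
  SupportedOn G A = ∀ i j → i ≢ j → ¬ SimpleGraph.Adj G i j → A i j ≈ 0#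

-- Write S = F_{π_n} ⋯ F_{π_1} for the system map and pos v for the step at
-- which vertex v is updated.  When v_i is updated, row i of the current
-- product becomes Σ_l a_il (row l), and at that moment row l is already
-- final if pos l < pos i and is still the unit row e_l otherwise.  Hence
--
--     S = A_π S + (A − A_π),   i.e.   (I − A_π) S = A − A_π.          (*)
--
-- Since A_π is strictly lower triangular in the update order, I − A_π is
-- left-cancellable (well-founded induction on pos), so a right inverse of
-- I − A_π is two-sided.  A right inverse is again a system map: applying (*)
-- to the matrix I + A_π, whose triangular part is A_π, gives
-- (I − A_π) B = I for B the system map of I + A_π.  Then
-- S = (B (I − A_π)) S = B (A − A_π).

module Submission where

open import Defs
open import Level using (Level)
open import Data.Nat using (ℕ)
open import Data.Fin.Permutation using (Permutation′)
open import Data.Product using (Σ; _×_)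

import Data.Nat as ℕ
import Data.Nat.Induction as ℕ
import Data.Nat.Properties as ℕ
open import Data.Fin using (Fin; zero; suc; toℕ; _≟_; _<_; _<?_)
open import Data.Fin.Properties using (suc-injective; <⇒≢)
open import Data.Fin.Permutation using (_⟨$⟩ʳ_; _⟨$⟩ˡ_; inverseˡ; inverseʳ)
open import Data.List using ([]; _∷_; _++_; map; allFin; tabulate)
open import Data.List.Properties using (map-++; map-tabulate)
open import Data.List.Relation.Unary.All as All using (All; []; _∷_)
open import Data.List.Relation.Unary.All.Properties using (map⁺)
open import Data.Product using (_,_; ∃₂)
open import Function using (id; _∘_)
open import Data.Empty using (⊥-elim)
open import Relation.Nullary using (¬_; yes; no)
open import Relation.Nullary.Decidable using (toSum)
open import Data.Sum using ([_,_]′)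
open import Relation.Binary using (Setoid)
import Relation.Binary.Construct.On as On
open import Relation.Binary.PropositionalEquality as ≡ using (_≡_; _≢_; refl)
import Relation.Binary.Reasoning.Setoid as SetoidReasoning
import Induction.WellFounded as WF
import Algebra.Properties.AbelianGroup as AbelianGroupProperties
import Algebra.Properties.Ring as RingProperties
import Algebra.Properties.Semiring.Sum as SumProperties

position : ∀ {n} → Permutation′ n → Fin n → Fin n
position π v = π ⟨$⟩ˡ v

allFin-split : ∀ {n} (p : Fin n) →
  ∃₂ λ xs ys → allFin n ≡ xs ++ p ∷ ys × All (_< p) xs × All (p <_) ys
allFin-split {ℕ.suc n} zero =
  [] , map suc (allFin n) , ≡.cong (zero ∷_) (≡.sym (map-tabulate id suc)) ,
  [] , map⁺ (All.universal (λ _ → ℕ.z<s) (allFin n))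
allFin-split {ℕ.suc n} (suc p) with allFin-split p
... | xs , ys , split , smaller , larger =
  zero ∷ map suc xs , map suc ys , ≡.cong (zero ∷_) shifted ,
  ℕ.z<s ∷ map⁺ (All.map ℕ.s<s smaller) , map⁺ (All.map ℕ.s<s larger)
  where
  shifted : tabulate (suc {n}) ≡ map suc xs ++ suc p ∷ map suc ys
  shifted = ≡.trans (≡.sym (map-tabulate id suc))
             (≡.trans (≡.cong (map suc) split) (map-++ suc xs (p ∷ ys)))

module LinearSDSAlgebra {c ℓ : Level} (K : Field c ℓ) where
  open Field K hiding (zero)
    renaming (refl to ≈-refl; sym to ≈-sym; trans to ≈-trans)
  open LinearSDS K
  open SumProperties semiring
    using (sum; sum-cong-≋; sum-cong-≗; ∑-distrib-+; ∑-comm; *-distribˡ-sum; *-distribʳ-sum;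
           sum-replicate-zero)
  open AbelianGroupProperties +-abelianGroup using (⁻¹-∙-comm; ε⁻¹≈ε; xyx⁻¹≈y; ∙-cancelʳ)
  open RingProperties ring using ([y-z]x≈yx-zx)

  ≡⇒≈ : ∀ {x y} → x ≡ y → x ≈ y
  ≡⇒≈ refl = ≈-refl

  x-0≈x : ∀ x → x - 0# ≈ x
  x-0≈x x = ≈-trans (+-congˡ ε⁻¹≈ε) (+-identityʳ x)

  x+y-y≈x : ∀ x y → x + y - y ≈ x
  x+y-y≈x x y = ≈-trans (+-assoc x y (- y)) (≈-trans (+-congˡ (-‿inverseʳ y)) (+-identityʳ x))

  -- the contribution of a vertex updated earlier: its final row
  settled : ∀ x s w → x * s ≈ x * s + (x - x) * w
  settled x s w = ≈-sym (≈-trans (+-congˡ (≈-trans (*-congʳ (-‿inverseʳ x)) (zeroˡ w)))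
                                 (+-identityʳ (x * s)))

  -- the contribution of a vertex updated later: its unit row
  unsettled : ∀ x s w → x * w ≈ 0# * s + (x - 0#) * w
  unsettled x s w = ≈-sym (≈-trans (+-cong (zeroˡ s) (*-congʳ (x-0≈x x))) (+-identityˡ (x * w)))

  ∑≡sum : ∀ {m} (f : Fin m → Carrier) → ∑ f ≡ sum f
  ∑≡sum {ℕ.zero}  f = refl
  ∑≡sum {ℕ.suc m} f = ≡.cong (f zero +_) (∑≡sum (f ∘ suc))

  ∑-cong : ∀ {m} {f g : Fin m → Carrier} → (∀ k → f k ≈ g k) → ∑ f ≈ ∑ g
  ∑-cong {f = f} {g} f≈g rewrite ∑≡sum f | ∑≡sum g = sum-cong-≋ f≈g

  ∑-+ : ∀ {m} (f g : Fin m → Carrier) → ∑ (λ k → f k + g k) ≈ ∑ f + ∑ g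
  ∑-+ f g rewrite ∑≡sum (λ k → f k + g k) | ∑≡sum f | ∑≡sum g = ∑-distrib-+ f g

  ∑-*ˡ : ∀ {m} x (f : Fin m → Carrier) → x * ∑ f ≈ ∑ (λ k → x * f k)
  ∑-*ˡ x f rewrite ∑≡sum f | ∑≡sum (λ k → x * f k) = *-distribˡ-sum x f

  ∑-*ʳ : ∀ {m} x (f : Fin m → Carrier) → ∑ f * x ≈ ∑ (λ k → f k * x)
  ∑-*ʳ x f rewrite ∑≡sum f | ∑≡sum (λ k → f k * x) = *-distribʳ-sum x f

  ∑-zero : ∀ {m} (f : Fin m → Carrier) → (∀ k → f k ≈ 0#) → ∑ f ≈ 0#
  ∑-zero {m} f f≈0 rewrite ∑≡sum f = ≈-trans (sum-cong-≋ f≈0) (sum-replicate-zero m)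

  ∑-swap : ∀ {m p} (f : Fin m → Fin p → Carrier) →
    ∑ (λ k → ∑ (f k)) ≈ ∑ (λ l → ∑ (λ k → f k l))
  ∑-swap f = ≈-trans (≡⇒≈ (double f)) (≈-trans (∑-comm f) (≡⇒≈ (≡.sym (double (λ l k → f k l)))))
    where
    double : ∀ {m p} (g : Fin m → Fin p → Carrier) → ∑ (λ k → ∑ (g k)) ≡ sum (λ k → sum (g k))
    double g = ≡.trans (∑≡sum (λ k → ∑ (g k))) (sum-cong-≗ (λ k → ∑≡sum (g k)))

  ∑-neg : ∀ {m} (f : Fin m → Carrier) → ∑ (λ k → - f k) ≈ - ∑ f
  ∑-neg {ℕ.zero}  f = ≈-sym ε⁻¹≈ε
  ∑-neg {ℕ.suc m} f = ≈-trans (+-congˡ (∑-neg (f ∘ suc))) (⁻¹-∙-comm (f zero) (∑ (f ∘ suc)))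

  ∑-single : ∀ {m} (f : Fin m → Carrier) (v : Fin m) → (∀ k → k ≢ v → f k ≈ 0#) → ∑ f ≈ f v
  ∑-single {ℕ.suc m} f zero others =
    ≈-trans (+-congˡ (∑-zero (f ∘ suc) (λ k → others (suc k) (λ ())))) (+-identityʳ (f zero))
  ∑-single {ℕ.suc m} f (suc v) others =
    ≈-trans (+-congʳ (others zero (λ ())))
      (≈-trans (+-identityˡ _)
        (∑-single (f ∘ suc) v (λ k k≢v → others (suc k) (k≢v ∘ suc-injective))))

  ≋-setoid : ℕ → Setoid c ℓ
  ≋-setoid n = record
    { Carrier       = Matrix n
    ; _≈_           = _≋_
    ; isEquivalence = record
      { refl  = λ i j → ≈-refl
      ; sym   = λ M≋N i j → ≈-sym (M≋N i j)
      ; trans = λ M≋N N≋P i j → ≈-trans (M≋N i j) (N≋P i j)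
      }
    }

  module ≋ {n : ℕ} = Setoid (≋-setoid n)

  I-diag : ∀ {n} (i : Fin n) → I i i ≡ 1#
  I-diag i with i ≟ i
  ... | yes _  = refl
  ... | no i≢i = ⊥-elim (i≢i refl)

  I-off : ∀ {n} {i j : Fin n} → i ≢ j → I i j ≡ 0#
  I-off {i = i} {j} i≢j with i ≟ j
  ... | yes i≡j = ⊥-elim (i≢j i≡j)
  ... | no _    = refl

  ⊗-identityˡ : ∀ {n} (X : Matrix n) → (I ⊗ X) ≋ X
  ⊗-identityˡ X i j =
    ≈-trans (∑-single _ i (λ k k≢i → ≈-trans (*-congʳ (≡⇒≈ (I-off (k≢i ∘ ≡.sym)))) (zeroˡ _)))
      (≈-trans (*-congʳ (≡⇒≈ (I-diag i))) (*-identityˡ (X i j)))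

  ⊗-identityʳ : ∀ {n} (X : Matrix n) → (X ⊗ I) ≋ X
  ⊗-identityʳ X i j =
    ≈-trans (∑-single _ j (λ k k≢j → ≈-trans (*-congˡ (≡⇒≈ (I-off k≢j))) (zeroʳ _)))
      (≈-trans (*-congˡ (≡⇒≈ (I-diag j))) (*-identityʳ (X i j)))

  ⊗-cong : ∀ {n} {X X′ Y Y′ : Matrix n} → X ≋ X′ → Y ≋ Y′ → (X ⊗ Y) ≋ (X′ ⊗ Y′)
  ⊗-cong X≋X′ Y≋Y′ i j = ∑-cong (λ k → *-cong (X≋X′ i k) (Y≋Y′ k j))

  ⊖-cong : ∀ {n} {X X′ Y Y′ : Matrix n} → X ≋ X′ → Y ≋ Y′ → (X ⊖ Y) ≋ (X′ ⊖ Y′)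
  ⊖-cong X≋X′ Y≋Y′ i j = +-cong (X≋X′ i j) (-‿cong (Y≋Y′ i j))

  ⊗-assoc : ∀ {n} (X Y Z : Matrix n) → ((X ⊗ Y) ⊗ Z) ≋ (X ⊗ (Y ⊗ Z))
  ⊗-assoc X Y Z i j = begin
    ∑ (λ k → ∑ (λ l → X i l * Y l k) * Z k j)   ≈⟨ ∑-cong (λ k → ∑-*ʳ (Z k j) (λ l → X i l * Y l k)) ⟩
    ∑ (λ k → ∑ (λ l → X i l * Y l k * Z k j))   ≈⟨ ∑-swap (λ k l → X i l * Y l k * Z k j) ⟩
    ∑ (λ l → ∑ (λ k → X i l * Y l k * Z k j))   ≈⟨ ∑-cong (λ l → ∑-cong (λ k → *-assoc (X i l) (Y l k) (Z k j))) ⟩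
    ∑ (λ l → ∑ (λ k → X i l * (Y l k * Z k j))) ≈⟨ ∑-cong (λ l → ≈-sym (∑-*ˡ (X i l) (λ k → Y l k * Z k j))) ⟩
    ∑ (λ l → X i l * ∑ (λ k → Y l k * Z k j))   ∎
    where open SetoidReasoning setoid

  I⊖-⊗ : ∀ {n} (L X : Matrix n) → ((I ⊖ L) ⊗ X) ≋ (X ⊖ (L ⊗ X))
  I⊖-⊗ L X i j = begin
    ∑ (λ k → (I i k - L i k) * X k j)             ≈⟨ ∑-cong (λ k → [y-z]x≈yx-zx (X k j) (I i k) (L i k)) ⟩
    ∑ (λ k → I i k * X k j + - (L i k * X k j))   ≈⟨ ∑-+ (λ k → I i k * X k j) (λ k → - (L i k * X k j)) ⟩
    (I ⊗ X) i j + ∑ (λ k → - (L i k * X k j))     ≈⟨ +-cong (⊗-identityˡ X i j) (∑-neg (λ k → L i k * X k j)) ⟩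
    X i j - (L ⊗ X) i j                           ∎
    where open SetoidReasoning setoid

  F-row : ∀ {n} (M : Matrix n) v y → F M v v y ≡ M v y
  F-row M v y with v ≟ v
  ... | yes _  = refl
  ... | no v≢v = ⊥-elim (v≢v refl)

  F-other : ∀ {n} (M : Matrix n) v {x} y → x ≢ v → F M v x y ≡ I x y
  F-other M v {x} y x≢v with x ≟ v
  ... | yes x≡v = ⊥-elim (x≢v x≡v)
  ... | no _    = refl

  update-row : ∀ {n} (M : Matrix n) v (X : Matrix n) j →
    (F M v ⊗ X) v j ≈ ∑ (λ l → M v l * X l j)
  update-row M v X j = ∑-cong (λ l → *-congʳ (≡⇒≈ (F-row M v l)))

  update-other : ∀ {n} (M : Matrix n) v (X : Matrix n) {i} j → i ≢ v → (F M v ⊗ X) i j ≈ X i j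
  update-other M v X {i} j i≢v =
    ≈-trans (∑-cong (λ l → *-congʳ (≡⇒≈ (F-other M v l i≢v)))) (⊗-identityˡ X i j)

  compose-++ : ∀ {n} (M : Matrix n) xs ys → compose M (xs ++ ys) ≋ (compose M ys ⊗ compose M xs)
  compose-++ M []       ys = ≋.sym (⊗-identityʳ (compose M ys))
  compose-++ M (x ∷ xs) ys = ≋.trans (⊗-cong (compose-++ M xs ys) ≋.refl)
    (⊗-assoc (compose M ys) (compose M xs) (F M x))

  compose-untouched : ∀ {n} (M : Matrix n) ws {i} → All (i ≢_) ws →
    ∀ (X : Matrix n) j → (compose M ws ⊗ X) i j ≈ X i j
  compose-untouched M []       []             X j = ⊗-identityˡ X _ j
  compose-untouched M (w ∷ ws) (i≢w ∷ i∉ws) X j =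
    ≈-trans (⊗-assoc (compose M ws) (F M w) X _ j)
      (≈-trans (compose-untouched M ws i∉ws (F M w ⊗ X) j) (update-other M w X j i≢w))

  compose-prefix-row : ∀ {n} (M : Matrix n) xs ys {l} → All (l ≢_) ys →
    ∀ j → compose M (xs ++ ys) l j ≈ compose M xs l j
  compose-prefix-row M xs ys l∉ys j =
    ≈-trans (compose-++ M xs ys _ j) (compose-untouched M ys l∉ys (compose M xs) j)

  compose-absent-row : ∀ {n} (M : Matrix n) xs {l} → All (l ≢_) xs →
    ∀ j → compose M xs l j ≈ I l j
  compose-absent-row M xs l∉xs j =
    ≈-trans (≈-sym (⊗-identityʳ (compose M xs) _ j)) (compose-untouched M xs l∉xs I j)

  compose-row : ∀ {n} (M : Matrix n) xs ys {i} → All (i ≢_) ys →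
    ∀ j → compose M (xs ++ i ∷ ys) i j ≈ ∑ (λ l → M i l * compose M xs l j)
  compose-row M xs ys {i} i∉ys j = begin
    compose M (xs ++ i ∷ ys) i j                      ≈⟨ compose-++ M xs (i ∷ ys) i j ⟩
    ((compose M ys ⊗ F M i) ⊗ compose M xs) i j      ≈⟨ ⊗-assoc (compose M ys) (F M i) (compose M xs) i j ⟩
    (compose M ys ⊗ (F M i ⊗ compose M xs)) i j      ≈⟨ compose-untouched M ys i∉ys (F M i ⊗ compose M xs) j ⟩
    (F M i ⊗ compose M xs) i j                        ≈⟨ update-row M i (compose M xs) j ⟩
    ∑ (λ l → M i l * compose M xs l j)                ∎
    where open SetoidReasoning setoid

  schedule-split : ∀ {n} (π : Permutation′ n) (i : Fin n) →
    ∃₂ λ before after → schedule π ≡ before ++ i ∷ after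
      × All (λ v → position π v < position π i) before
      × All (λ v → position π i < position π v) after
  schedule-split {n} π i with allFin-split (position π i)
  ... | xs , ys , split , smaller , larger =
    map (π ⟨$⟩ʳ_) xs , map (π ⟨$⟩ʳ_) ys , schedule≡ ,
    map⁺ (All.map (≡.subst (_< position π i) (≡.sym (inverseˡ π))) smaller) ,
    map⁺ (All.map (≡.subst (position π i <_) (≡.sym (inverseˡ π))) larger)
    where
    schedule≡ : map (π ⟨$⟩ʳ_) (allFin n) ≡ map (π ⟨$⟩ʳ_) xs ++ i ∷ map (π ⟨$⟩ʳ_) ys
    schedule≡ = ≡.trans (≡.cong (map (π ⟨$⟩ʳ_)) split)
      (≡.trans (map-++ (π ⟨$⟩ʳ_) xs (position π i ∷ ys))
        (≡.cong (λ v → map (π ⟨$⟩ʳ_) xs ++ v ∷ map (π ⟨$⟩ʳ_) ys) (inverseʳ π)))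

  Aπ-below : ∀ {n} (M : Matrix n) π {i j} → position π j < position π i → Aπ M π i j ≡ M i j
  Aπ-below M π {i} {j} j<i with position π j <? position π i
  ... | yes _   = refl
  ... | no j≮i = ⊥-elim (j≮i j<i)

  Aπ-above : ∀ {n} (M : Matrix n) π {i j} → ¬ (position π j < position π i) → Aπ M π i j ≡ 0#
  Aπ-above M π {i} {j} j≮i with position π j <? position π i
  ... | yes j<i = ⊥-elim (j≮i j<i)
  ... | no _    = refl

  position-≢ : ∀ {n} (π : Permutation′ n) {u v} → position π u < position π v → u ≢ v
  position-≢ π u<v u≡v = <⇒≢ u<v (≡.cong (position π) u≡v)

  systemMap-row : ∀ {n} (M : Matrix n) π i j →
    systemMap M π i j ≈ (Aπ M π ⊗ systemMap M π) i j + (M ⊖ Aπ M π) i j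
  systemMap-row M π i j with schedule-split π i
  ... | before , after , split , earlier , later = begin
    systemMap M π i j                                   ≡⟨ ≡.cong (λ w → compose M w i j) split ⟩
    compose M (before ++ i ∷ after) i j                 ≈⟨ compose-row M before after i∉after j ⟩
    ∑ (λ l → M i l * C l j)                             ≈⟨ ∑-cong term ⟩
    ∑ (λ l → Aπ M π i l * S l j + (M ⊖ Aπ M π) i l * I l j)
        ≈⟨ ∑-+ (λ l → Aπ M π i l * S l j) (λ l → (M ⊖ Aπ M π) i l * I l j) ⟩
    (Aπ M π ⊗ S) i j + ((M ⊖ Aπ M π) ⊗ I) i j          ≈⟨ +-congˡ (⊗-identityʳ (M ⊖ Aπ M π) i j) ⟩
    (Aπ M π ⊗ S) i j + (M ⊖ Aπ M π) i j                ∎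
    where
    open SetoidReasoning setoid
    C : Matrix _
    C = compose M before
    S : Matrix _
    S = systemMap M π
    i∉after : All (i ≢_) after
    i∉after = All.map (position-≢ π) later
    final-row : ∀ {l} → position π l < position π i → C l j ≈ S l j
    final-row l<i = ≈-trans (≈-sym (compose-prefix-row M before (i ∷ after) l∉rest j))
                            (≡⇒≈ (≡.cong (λ w → compose M w _ j) (≡.sym split)))
      where
      l∉rest : All (_ ≢_) (i ∷ after)
      l∉rest = position-≢ π l<i ∷ All.map (λ i<v → position-≢ π (ℕ.<-trans l<i i<v)) later
    unit-row : ∀ {l} → ¬ (position π l < position π i) → C l j ≈ I l j
    unit-row l≮i = compose-absent-row M before l∉before j
      where
      l∉before : All (_ ≢_) before
      l∉before = All.map (λ v<i l≡v → l≮i (≡.subst _ (≡.sym l≡v) v<i)) earlier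
    term : ∀ l → M i l * C l j ≈ Aπ M π i l * S l j + (M ⊖ Aπ M π) i l * I l j
    term l = [ updatedBefore , notUpdatedBefore ]′ (toSum (position π l <? position π i))
      where
      updatedBefore : position π l < position π i →
        M i l * C l j ≈ Aπ M π i l * S l j + (M ⊖ Aπ M π) i l * I l j
      updatedBefore l<i = ≈-trans (*-congˡ (final-row l<i)) (≈-trans (settled (M i l) (S l j) (I l j))
        (≡⇒≈ (≡.cong (λ a → a * S l j + (M i l - a) * I l j) (≡.sym (Aπ-below M π l<i)))))
      notUpdatedBefore : ¬ (position π l < position π i) →
        M i l * C l j ≈ Aπ M π i l * S l j + (M ⊖ Aπ M π) i l * I l j
      notUpdatedBefore l≮i = ≈-trans (*-congˡ (unit-row l≮i)) (≈-trans (unsettled (M i l) (S l j) (I l j))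
        (≡⇒≈ (≡.cong (λ a → a * S l j + (M i l - a) * I l j) (≡.sym (Aπ-above M π l≮i)))))

  systemMap-fixedPoint : ∀ {n} (M : Matrix n) π → ((I ⊖ Aπ M π) ⊗ systemMap M π) ≋ (M ⊖ Aπ M π)
  systemMap-fixedPoint M π i j =
    ≈-trans (I⊖-⊗ (Aπ M π) (systemMap M π) i j)
      (≈-trans (+-congʳ (systemMap-row M π i j)) (xyx⁻¹≈y _ _))

  StrictlyLower : ∀ {n} → (Fin n → ℕ) → Matrix n → Set ℓ
  StrictlyLower rank L = ∀ i l → ¬ (rank l ℕ.< rank i) → L i l ≈ 0#

  -- I − L is left-cancellable when L is strictly lower triangular: row i of
  -- X is determined by row i of (I − L) X and the rows of lower rank.
  unipotent-cancel : ∀ {n} (rank : Fin n → ℕ) {L X Y : Matrix n} → StrictlyLower rank L →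
    ((I ⊖ L) ⊗ X) ≋ ((I ⊖ L) ⊗ Y) → X ≋ Y
  unipotent-cancel {n} rank {L} {X} {Y} lower NX≋NY =
    wfRec (λ i → ∀ j → X i j ≈ Y i j) rowsAgree
    where
    open WF.All (On.wellFounded rank ℕ.<-wellFounded) ℓ using (wfRec)
    rowsAgree : ∀ i → (∀ {l} → rank l ℕ.< rank i → ∀ j → X l j ≈ Y l j) → ∀ j → X i j ≈ Y i j
    rowsAgree i lowerRowsAgree j = ∙-cancelʳ (- (L ⊗ Y) i j) (X i j) (Y i j) (begin
      X i j - (L ⊗ Y) i j       ≈⟨ +-congˡ (-‿cong (≈-sym (∑-cong term))) ⟩
      X i j - (L ⊗ X) i j       ≈⟨ ≈-sym (I⊖-⊗ L X i j) ⟩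
      ((I ⊖ L) ⊗ X) i j         ≈⟨ NX≋NY i j ⟩
      ((I ⊖ L) ⊗ Y) i j         ≈⟨ I⊖-⊗ L Y i j ⟩
      Y i j - (L ⊗ Y) i j       ∎)
      where
      open SetoidReasoning setoid
      term : ∀ l → L i l * X l j ≈ L i l * Y l j
      term l = [ (λ l<i → *-congˡ (lowerRowsAgree l<i j))
               , (λ l≮i → ≈-trans (*-congʳ (lower i l l≮i))
                            (≈-trans (zeroˡ (X l j)) (≈-sym (≈-trans (*-congʳ (lower i l l≮i)) (zeroˡ (Y l j))))))
               ]′ (toSum (rank l ℕ.<? rank i))

  right⇒left-inverse : ∀ {n} (rank : Fin n → ℕ) {L B : Matrix n} → StrictlyLower rank L →
    ((I ⊖ L) ⊗ B) ≋ I → (B ⊗ (I ⊖ L)) ≋ I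
  right⇒left-inverse rank {L} {B} lower NB≋I = unipotent-cancel rank lower (begin
    (I ⊖ L) ⊗ (B ⊗ (I ⊖ L))   ≈⟨ ≋.sym (⊗-assoc (I ⊖ L) B (I ⊖ L)) ⟩
    ((I ⊖ L) ⊗ B) ⊗ (I ⊖ L)   ≈⟨ ⊗-cong NB≋I ≋.refl ⟩
    I ⊗ (I ⊖ L)               ≈⟨ ⊗-identityˡ (I ⊖ L) ⟩
    I ⊖ L                     ≈⟨ ≋.sym (⊗-identityʳ (I ⊖ L)) ⟩
    (I ⊖ L) ⊗ I               ∎)
    where open SetoidReasoning (≋-setoid _)

  Aπ-strictlyLower : ∀ {n} (M : Matrix n) π → StrictlyLower (toℕ ∘ position π) (Aπ M π)
  Aπ-strictlyLower M π i l l≮i = ≡⇒≈ (Aπ-above M π l≮i)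

  _⊕_ : ∀ {n} → Matrix n → Matrix n → Matrix n
  (M ⊕ N) i j = M i j + N i j

  Aπ-of-I⊕Aπ : ∀ {n} (A : Matrix n) π → Aπ (I ⊕ Aπ A π) π ≋ Aπ A π
  Aπ-of-I⊕Aπ A π i j = [ below , notBelow ]′ (toSum (position π j <? position π i))
    where
    below : position π j < position π i → Aπ (I ⊕ Aπ A π) π i j ≈ Aπ A π i j
    below j<i = ≈-trans (≡⇒≈ (Aπ-below (I ⊕ Aπ A π) π j<i))
      (≈-trans (+-congʳ (≡⇒≈ (I-off (position-≢ π j<i ∘ ≡.sym)))) (+-identityˡ (Aπ A π i j)))
    notBelow : ¬ (position π j < position π i) → Aπ (I ⊕ Aπ A π) π i j ≈ Aπ A π i j
    notBelow j≮i = ≡⇒≈ (≡.trans (Aπ-above (I ⊕ Aπ A π) π j≮i) (≡.sym (Aπ-above A π j≮i)))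

  inverse-right : ∀ {n} (A : Matrix n) π → ((I ⊖ Aπ A π) ⊗ systemMap (I ⊕ Aπ A π) π) ≋ I
  inverse-right A π = begin
    (I ⊖ Aπ A π) ⊗ B                         ≈⟨ ⊗-cong (⊖-cong ≋.refl (≋.sym (Aπ-of-I⊕Aπ A π))) ≋.refl ⟩
    (I ⊖ Aπ (I ⊕ Aπ A π) π) ⊗ B              ≈⟨ systemMap-fixedPoint (I ⊕ Aπ A π) π ⟩
    (I ⊕ Aπ A π) ⊖ Aπ (I ⊕ Aπ A π) π         ≈⟨ ⊖-cong ≋.refl (Aπ-of-I⊕Aπ A π) ⟩
    (I ⊕ Aπ A π) ⊖ Aπ A π                    ≈⟨ (λ i j → x+y-y≈x (I i j) (Aπ A π i j)) ⟩
    I                                        ∎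
    where
    open SetoidReasoning (≋-setoid _)
    B : Matrix _
    B = systemMap (I ⊕ Aπ A π) π

theorem1 : ∀ {c ℓ : Level} (K : Field c ℓ) (n : ℕ) (G : SimpleGraph n) → Connected G →
    (A : LinearSDS.Matrix K n) → LinearSDS.SupportedOn K G A → (π : Permutation′ n) →
    Σ (LinearSDS.Matrix K n) λ B →
      LinearSDS.IsInverseOf K B (LinearSDS._⊖_ K (LinearSDS.I K) (LinearSDS.Aπ K A π))
      × LinearSDS._≋_ K (LinearSDS.systemMap K A π)
          (LinearSDS._⊗_ K B (LinearSDS._⊖_ K A (LinearSDS.Aπ K A π)))
theorem1 K n _ _ A _ π = B , (B-left , B-right) , factorisation
  where
  open LinearSDS K
  open LinearSDSAlgebra K
  open SetoidReasoning (≋-setoid n)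
  N : Matrix n
  N = I ⊖ Aπ A π
  B : Matrix n
  B = systemMap (I ⊕ Aπ A π) π
  B-right : (N ⊗ B) ≋ I
  B-right = inverse-right A π
  B-left : (B ⊗ N) ≋ I
  B-left = right⇒left-inverse (toℕ ∘ position π) (Aπ-strictlyLower A π) B-right
  factorisation : systemMap A π ≋ (B ⊗ (A ⊖ Aπ A π))
  factorisation = begin
    systemMap A π               ≈⟨ ≋.sym (⊗-identityˡ (systemMap A π)) ⟩
    I ⊗ systemMap A π           ≈⟨ ⊗-cong (≋.sym B-left) ≋.refl ⟩
    (B ⊗ N) ⊗ systemMap A π     ≈⟨ ⊗-assoc B N (systemMap A π) ⟩
    B ⊗ (N ⊗ systemMap A π)     ≈⟨ ⊗-cong ≋.refl (systemMap-fixedPoint A π) ⟩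
    B ⊗ (A ⊖ Aπ A π)            ∎
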